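{- Let $p$ be a prime and $k,n$ positive integers. Then: (1) $P(p^{k+1},n)$ equals either $P(p^k,n)$ or $p\,P(p^k,n)$. (2) If $k\ge 2$ and $P(p^{k+1},n)=p\,P(p^k,n)$, then $P(p^{k+2},n)=p\,P(p^{k+1},n)$. (3) If $P(p^{N+1},n)=p\,P(p^N,n)$ for some integer $N\ge 2$, then $P(p^{N+j},n)=p^{j}P(p^N,n)$ for all positive integers $j$.
   Context: For positive integers $m,n$, let $\mathbf{Z}_m$ be the ring of integers modulo $m$ and define $T:\mathbf{Z}_m^n\to\mathbf{Z}_m^n$ by $T(a_0,\dots,a_{n-1})=(a_0+a_1,a_1+a_2,\dots,a_{n-2}+a_{n-1},a_{n-1}+a_0)$. For $\mathbf{a}\in\mathbf{Z}_m^n$, the cycle length of $(T^k\mathbf{a})_{k\ge0}$ is the smallest positive integer $P$ for which there exists $N$ with $T^{k+P}\mathbf{a}=T^k\mathbf{a}$ for all $k\ge N$. The period $P(m,n)$ is the maximum of these cycle lengths over all $\mathbf{a}\in\mathbf{Z}_m^n$. -}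

module Defs where

open import Data.Nat using (ℕ; zero; suc; _+_; _*_; _≤_; _<_; _%_)
open import Data.Nat.DivMod using (m%n<n)
open import Data.Fin using (Fin; toℕ; fromℕ<)
open import Data.Product using (Σ; _×_; ∃)
open import Relation.Binary.PropositionalEquality using (_≡_)

_+ₘ_ : ∀ {m} → Fin m → Fin m → Fin m
_+ₘ_ {suc m} x y = fromℕ< (m%n<n (toℕ x + toℕ y) (suc m))

next : ∀ {n} → Fin n → Fin n
next {suc n} i = fromℕ< (m%n<n (suc (toℕ i)) (suc n))

Vecₘ : ℕ → ℕ → Set
Vecₘ m n = Fin n → Fin m

T : ∀ {m n} → Vecₘ m n → Vecₘ m n
T a i = a i +ₘ a (next i)

T^ : ∀ {m n} → ℕ → Vecₘ m n → Vecₘ m n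
T^ zero    a = a
T^ (suc k) a = T (T^ k a)

EventuallyRepeats : ∀ {m n} → Vecₘ m n → ℕ → Set
EventuallyRepeats a P = ∃ λ N → ∀ k → N ≤ k → ∀ i → T^ (k + P) a i ≡ T^ k a i

IsCycleLength : ∀ {m n} → Vecₘ m n → ℕ → Set
IsCycleLength a L =
  0 < L × EventuallyRepeats a L × (∀ P → 0 < P → EventuallyRepeats a P → L ≤ P)

IsPeriod : ℕ → ℕ → ℕ → Set
IsPeriod m n P =
  (Σ (Vecₘ m n) λ a → IsCycleLength a P) ×
  (∀ (a : Vecₘ m n) L → IsCycleLength a L → L ≤ P)

-- Work over ℤ: P is a period of T modulo m when every integer vector b satisfies
-- T^(N+P) b ≡ T^N b (mod m) for large N, and P(m,n) is the least such P; by linearity and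
-- rotation invariance of T it is the cycle length of the unit vector. If T^(N+P) b = T^N b + m·w
-- with w itself P-periodic mod m, then T^(N+jP) b ≡ T^N b + j·m·w (mod m²). Taking j = d with
-- d ∣ m makes d·P a period mod d·m, so P(m,n) ∣ P(dm,n) ∣ d·P(m,n), which for m = pᵏ is (1).
-- If moreover d² ∣ m and d·Q were still a period mod d²·m, the same congruence would force d ∣ w,
-- making Q a period mod d·m. For m = pᵏ with k ≥ 2 this says that once the period is multiplied
-- by p it keeps being multiplied by p, which gives (2) and, by induction, (3).
module Submission where

open import Defs

open import Data.Nat as ℕ using (ℕ; zero; suc; _+_; _*_; _^_; _∸_; _≤_; _<_; s≤s; z≤n; NonZero)
import Data.Nat.Properties as ℕ
import Data.Nat.Divisibility as ℕ
open import Data.Nat.DivMod using (_%_; _/_; m≡m%n+[m/n]*n; m%n<n; n%n≡0; m<n⇒m%n≡m)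
open import Data.Nat.Induction using (<-wellFounded)
open import Data.Nat.Primality using (Prime; prime⇒nonZero; prime⇒nonTrivial; prime⇒irreducible)
import Data.Nat.Tactic.RingSolver as ℕ-Solver
open import Data.Integer as ℤ using (ℤ; +_; _-_; -_; _⊖_; 0ℤ; 1ℤ; ∣_∣)
  renaming (_+_ to _+ℤ_; _*_ to _*ℤ_)
import Data.Integer.Properties as ℤ
open import Data.Integer.Divisibility.Signed
open import Data.Integer.Tactic.RingSolver using (solve-∀)
open import Algebra.Properties.Monoid.Sum ℤ.+-0-monoid using (sum; sum-cong-≗; sum-replicate-zero)
open import Data.Fin as Fin using (Fin; toℕ; fromℕ<; fromℕ; inject₁)
import Data.Fin.Properties as Fin
open import Data.Fin.Induction using (>-weakInduction)
open import Data.Product using (∃; ∃₂; _×_; _,_; proj₁; proj₂; uncurry)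
open import Data.Sum as Sum using (_⊎_; inj₁; inj₂)
open import Function using (_$_; _∘_; id)
open import Induction.WellFounded using (Acc; acc)
open import Level using (0ℓ)
open import Relation.Binary using (IsEquivalence; Setoid)
import Relation.Binary.Reasoning.Setoid as SetoidReasoning
open import Relation.Binary.PropositionalEquality
open import Relation.Nullary using (Dec; yes; no; contradiction)
import Relation.Nullary.Decidable as Dec
open import Relation.Nullary.Decidable using (_×-dec_)
open import Relation.Unary using (Pred; Decidable)

infix 4 _≡_mod_

record _≡_mod_ (x y : ℤ) (m : ℕ) : Set where
  constructor mk≡mod
  field ∣-difference : + m ∣ x - y

open _≡_mod_

module _ {m : ℕ} where

  mod-reflexive : ∀ {x y} → x ≡ y → x ≡ y mod m
  mod-reflexive {x} refl = mk≡mod (divides 0ℤ (ℤ.+-inverseʳ x))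

  mod-refl : ∀ {x} → x ≡ x mod m
  mod-refl = mod-reflexive refl

  mod-sym : ∀ {x y} → x ≡ y mod m → y ≡ x mod m
  mod-sym {x} {y} (mk≡mod m∣x-y) = mk≡mod (subst (+ m ∣_) (lemma x y) (∣m⇒∣-m m∣x-y))
    where lemma : ∀ x y → - (x - y) ≡ y - x
          lemma = solve-∀

  mod-trans : ∀ {x y z} → x ≡ y mod m → y ≡ z mod m → x ≡ z mod m
  mod-trans {x} {y} {z} (mk≡mod m∣x-y) (mk≡mod m∣y-z) =
    mk≡mod (subst (+ m ∣_) (lemma x y z) (∣m∣n⇒∣m+n m∣x-y m∣y-z))
    where lemma : ∀ x y z → (x - y) +ℤ (y - z) ≡ x - z
          lemma = solve-∀

  mod-+ : ∀ {x y u v} → x ≡ y mod m → u ≡ v mod m → x +ℤ u ≡ y +ℤ v mod m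
  mod-+ {x} {y} {u} {v} (mk≡mod m∣x-y) (mk≡mod m∣u-v) =
    mk≡mod (subst (+ m ∣_) (lemma x y u v) (∣m∣n⇒∣m+n m∣x-y m∣u-v))
    where lemma : ∀ x y u v → (x - y) +ℤ (u - v) ≡ (x +ℤ u) - (y +ℤ v)
          lemma = solve-∀

  mod-*ˡ : ∀ c {x y} → x ≡ y mod m → c *ℤ x ≡ c *ℤ y mod m
  mod-*ˡ c {x} {y} (mk≡mod m∣x-y) = mk≡mod (subst (+ m ∣_) (lemma c x y) (∣n⇒∣m*n c m∣x-y))
    where lemma : ∀ c x y → c *ℤ (x - y) ≡ c *ℤ x - c *ℤ y
          lemma = solve-∀

  mod-+-cancelˡ : ∀ c {x y} → c +ℤ x ≡ c +ℤ y mod m → x ≡ y mod m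
  mod-+-cancelˡ c {x} {y} c+x≡c+y =
    subst₂ (λ u v → u ≡ v mod m) (lemma c x) (lemma c y) (mod-+ (mod-refl {x = - c}) c+x≡c+y)
    where lemma : ∀ c x → - c +ℤ (c +ℤ x) ≡ x
          lemma = solve-∀

  ∣⇒x+z≡x-mod : ∀ {x z} → + m ∣ z → x +ℤ z ≡ x mod m
  ∣⇒x+z≡x-mod {x} {z} m∣z = mk≡mod (subst (+ m ∣_) (lemma x z) m∣z)
    where lemma : ∀ x z → z ≡ (x +ℤ z) - x
          lemma = solve-∀

  x+z≡x-mod⇒∣ : ∀ {x z} → x +ℤ z ≡ x mod m → + m ∣ z
  x+z≡x-mod⇒∣ {x} {z} (mk≡mod m∣x+z-x) = subst (+ m ∣_) (lemma x z) m∣x+z-x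
    where lemma : ∀ x z → (x +ℤ z) - x ≡ z
          lemma = solve-∀

mod-∣ : ∀ {m m′ x y} → m ℕ.∣ m′ → x ≡ y mod m′ → x ≡ y mod m
mod-∣ m∣m′ (mk≡mod m′∣x-y) = mk≡mod (∣-trans (∣ᵤ⇒∣ m∣m′) m′∣x-y)

mod-scale : ∀ c {m x y} → x ≡ y mod m → + c *ℤ x ≡ + c *ℤ y mod c * m
mod-scale c {m} {x} {y} (mk≡mod m∣x-y) = mk≡mod $
  subst₂ _∣_ (sym (ℤ.pos-* c m)) (lemma (+ c) x y) (*-monoʳ-∣ (+ c) m∣x-y)
  where lemma : ∀ c x y → c *ℤ (x - y) ≡ c *ℤ x - c *ℤ y
        lemma = solve-∀

≡+*⇒≡-mod : ∀ {a b c m} → a ≡ b + c * m → + a ≡ + b mod m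
≡+*⇒≡-mod {a} {b} {c} {m} refl = mk≡mod $ divides (+ c) (begin
  + (b + c * m) - + b       ≡⟨ cong (_- + b) (ℤ.pos-+ b (c * m)) ⟩
  (+ b +ℤ + (c * m)) - + b  ≡⟨ cong (λ z → (+ b +ℤ z) - + b) (ℤ.pos-* c m) ⟩
  (+ b +ℤ + c *ℤ + m) - + b ≡⟨ lemma (+ b) (+ c) (+ m) ⟩
  + c *ℤ + m                ∎)
  where
    open ≡-Reasoning
    lemma : ∀ b c m → (b +ℤ c *ℤ m) - b ≡ c *ℤ m
    lemma = solve-∀

%-≡-mod : ∀ a m .{{_ : NonZero m}} → + (a % m) ≡ + a mod m
%-≡-mod a m = mod-sym (≡+*⇒≡-mod {c = a / m} (m≡m%n+[m/n]*n a m))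

≡-mod⇒≡ : ∀ {a b m} → a < m → b < m → + a ≡ + b mod m → a ≡ b
≡-mod⇒≡ {a} {b} {m} a<m b<m (mk≡mod m∣a-b) with ∣ + a - + b ∣ in eq
... | zero  = ℤ.+-injective (ℤ.i-j≡0⇒i≡j (+ a) (+ b) (ℤ.∣i∣≡0⇒i≡0 eq))
... | suc d = contradiction (ℕ.∣⇒≤ (subst (m ℕ.∣_) eq (∣⇒∣ᵤ m∣a-b))) (ℕ.<⇒≱ ∣a-b∣<m)
  where
    ∣a-b∣<m : suc d < m
    ∣a-b∣<m = begin-strict
      suc d         ≡⟨ sym eq ⟩
      ∣ + a - + b ∣ ≡⟨ cong ∣_∣ (ℤ.m-n≡m⊖n a b) ⟩
      ∣ a ⊖ b ∣     ≤⟨ ℤ.∣m⊝n∣≤m⊔n a b ⟩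
      a ℕ.⊔ b       <⟨ ℕ.⊔-lub a<m b<m ⟩
      m             ∎
      where open ℕ.≤-Reasoning

mod⇒≡+* : ∀ {x y m} → x ≡ y mod m → ∃ λ q → x ≡ y +ℤ + m *ℤ q
mod⇒≡+* {x} {y} {m} (mk≡mod (divides q x-y≡q*m)) = q , (begin
  x                      ≡⟨ lemma x y ⟩
  y +ℤ (x - y)           ≡⟨ cong (y +ℤ_) x-y≡q*m ⟩
  y +ℤ q *ℤ + m          ≡⟨ cong (y +ℤ_) (ℤ.*-comm q (+ m)) ⟩
  y +ℤ + m *ℤ q          ∎)
  where
    open ≡-Reasoning
    lemma : ∀ x y → x ≡ y +ℤ (x - y)
    lemma = solve-∀

_≡?_mod_ : ∀ x y m → Dec (x ≡ y mod m)
x ≡? y mod m = Dec.map′ mk≡mod ∣-difference (+ m ∣? x - y)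

mod-isEquivalence : ∀ m → IsEquivalence (λ x y → x ≡ y mod m)
mod-isEquivalence m = record { refl = mod-refl ; sym = mod-sym ; trans = mod-trans }

mod-setoid : ℕ → Setoid 0ℓ 0ℓ
mod-setoid m = record { isEquivalence = mod-isEquivalence m }

module ≡-mod-Reasoning (m : ℕ) = SetoidReasoning (mod-setoid m)

least-satisfying : ∀ {p} {P : Pred ℕ p} → Decidable P → ∀ {x} → P x →
                   ∃ λ l → P l × (∀ y → P y → l ≤ y)
least-satisfying {P = P} P? {x} = go x (<-wellFounded x)
  where
    go : ∀ x → Acc _<_ x → P x → ∃ λ l → P l × (∀ y → P y → l ≤ y)
    go x (acc rec) Px with ℕ.anyUpTo? P? x
    ... | yes (y , y<x , Py) = go y (rec y<x) Py
    ... | no ∄y<x            = x , Px , λ y Py → ℕ.≮⇒≥ (λ y<x → ∄y<x (y , y<x , Py))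

m∣n∣p*m⇒n≡m⊎n≡p*m : ∀ {p m n} → Prime p → 0 < m → m ℕ.∣ n → n ℕ.∣ p * m →
                     n ≡ m ⊎ n ≡ p * m
m∣n∣p*m⇒n≡m⊎n≡p*m {p} {m} p-prime 0<m (ℕ.divides-refl c) cm∣pm
  with prime⇒irreducible p-prime (ℕ.*-cancelʳ-∣ {c} {p} m {{ℕ.>-nonZero 0<m}} cm∣pm)
... | inj₁ refl = inj₁ (ℕ.*-identityˡ m)
... | inj₂ refl = inj₂ refl

toℕ-+ₘ : ∀ {m} (x y : Fin (suc m)) → + toℕ (x +ₘ y) ≡ + toℕ x +ℤ + toℕ y mod suc m
toℕ-+ₘ {m} x y =
  mod-trans (mod-reflexive (cong +_ (Fin.toℕ-fromℕ< _))) (%-≡-mod (toℕ x + toℕ y) (suc m))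

module _ {n : ℕ} where

  toℕ-next : (i : Fin (suc n)) → toℕ (next i) ≡ suc (toℕ i) % suc n
  toℕ-next i = Fin.toℕ-fromℕ< _

  next-injective : ∀ {i j : Fin (suc n)} → next i ≡ next j → i ≡ j
  next-injective {i} {j} eq = Fin.toℕ-injective $ ≡-mod⇒≡ (Fin.toℕ<n i) (Fin.toℕ<n j) $
    mod-+-cancelˡ 1ℤ $ begin
      + suc (toℕ i)    ≈⟨ residue i ⟨
      + toℕ (next i)   ≡⟨ cong (+_ ∘ toℕ) eq ⟩
      + toℕ (next j)   ≈⟨ residue j ⟩
      + suc (toℕ j)    ∎
    where
      open ≡-mod-Reasoning (suc n)
      residue : ∀ k → + toℕ (next k) ≡ + suc (toℕ k) mod suc n
      residue k = subst (λ r → + r ≡ + suc (toℕ k) mod suc n) (sym (toℕ-next k))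
                        (%-≡-mod (suc (toℕ k)) (suc n))

  next-fromℕ : next (fromℕ n) ≡ Fin.zero
  next-fromℕ = Fin.toℕ-injective $ begin
    toℕ (next (fromℕ n))        ≡⟨ toℕ-next (fromℕ n) ⟩
    suc (toℕ (fromℕ n)) % suc n ≡⟨ cong (λ k → suc k % suc n) (Fin.toℕ-fromℕ n) ⟩
    suc n % suc n               ≡⟨ n%n≡0 (suc n) ⟩
    0                           ∎
    where open ≡-Reasoning

  next-inject₁ : (i : Fin n) → next (inject₁ i) ≡ Fin.suc i
  next-inject₁ i = Fin.toℕ-injective $ begin
    toℕ (next (inject₁ i))        ≡⟨ toℕ-next (inject₁ i) ⟩
    suc (toℕ (inject₁ i)) % suc n ≡⟨ cong (λ k → suc k % suc n) (Fin.toℕ-inject₁ i) ⟩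
    suc (toℕ i) % suc n           ≡⟨ m<n⇒m%n≡m (s≤s (Fin.toℕ<n i)) ⟩
    suc (toℕ i)                   ∎
    where open ≡-Reasoning

indicator : ∀ {k} → Fin k → Fin k → ℤ
indicator Fin.zero    Fin.zero    = 1ℤ
indicator Fin.zero    (Fin.suc _) = 0ℤ
indicator (Fin.suc _) Fin.zero    = 0ℤ
indicator (Fin.suc j) (Fin.suc i) = indicator j i

indicator-diagonal : ∀ {k} (i : Fin k) → indicator i i ≡ 1ℤ
indicator-diagonal Fin.zero    = refl
indicator-diagonal (Fin.suc i) = indicator-diagonal i

indicator-off-diagonal : ∀ {k} {j i : Fin k} → j ≢ i → indicator j i ≡ 0ℤ
indicator-off-diagonal {j = Fin.zero}  {Fin.zero}  j≢i = contradiction refl j≢i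
indicator-off-diagonal {j = Fin.zero}  {Fin.suc i} j≢i = refl
indicator-off-diagonal {j = Fin.suc j} {Fin.zero}  j≢i = refl
indicator-off-diagonal {j = Fin.suc j} {Fin.suc i} j≢i = indicator-off-diagonal (j≢i ∘ cong Fin.suc)

indicator-next : ∀ {n} (j i : Fin (suc n)) → indicator (next j) (next i) ≡ indicator j i
indicator-next j i with j Fin.≟ i
... | yes refl = trans (indicator-diagonal (next j)) (sym (indicator-diagonal j))
... | no j≢i   = trans (indicator-off-diagonal (j≢i ∘ next-injective)) (sym (indicator-off-diagonal j≢i))

sum-indicator : ∀ {k} (a : Fin k → ℤ) i → sum (λ j → a j *ℤ indicator j i) ≡ a i
sum-indicator {suc k} a Fin.zero = begin
  a Fin.zero *ℤ 1ℤ +ℤ sum (λ j → a (Fin.suc j) *ℤ 0ℤ)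
    ≡⟨ cong₂ _+ℤ_ (ℤ.*-identityʳ (a Fin.zero)) (sum-cong-≗ (ℤ.*-zeroʳ ∘ a ∘ Fin.suc)) ⟩
  a Fin.zero +ℤ sum {k} (λ _ → 0ℤ)
    ≡⟨ cong (a Fin.zero +ℤ_) (sum-replicate-zero k) ⟩
  a Fin.zero +ℤ 0ℤ
    ≡⟨ ℤ.+-identityʳ (a Fin.zero) ⟩
  a Fin.zero
    ∎
  where open ≡-Reasoning
sum-indicator {suc k} a (Fin.suc i) = begin
  a Fin.zero *ℤ 0ℤ +ℤ sum (λ j → a (Fin.suc j) *ℤ indicator j i)
    ≡⟨ cong₂ _+ℤ_ (ℤ.*-zeroʳ (a Fin.zero)) (sum-indicator (a ∘ Fin.suc) i) ⟩
  0ℤ +ℤ a (Fin.suc i)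
    ≡⟨ ℤ.+-identityˡ (a (Fin.suc i)) ⟩
  a (Fin.suc i)
    ∎
  where open ≡-Reasoning

isPeriod-unique : ∀ {m n Q Q′} → IsPeriod m n Q → IsPeriod m n Q′ → Q ≡ Q′
isPeriod-unique ((a , cycle-a) , maximal) ((a′ , cycle-a′) , maximal′) =
  ℕ.≤-antisym (maximal′ a _ cycle-a) (maximal a′ _ cycle-a′)

module Orbits (n : ℕ) where

  Vecℤ : Set
  Vecℤ = Fin (suc n) → ℤ

  infix 4 _≋_mod_

  _≋_mod_ : Vecℤ → Vecℤ → ℕ → Set
  a ≋ b mod m = ∀ i → a i ≡ b i mod m

  e₀ : Vecℤ
  e₀ = indicator Fin.zero

  Tℤ : Vecℤ → Vecℤ
  Tℤ a i = a i +ℤ a (next i)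

  Tℤ^ : ℕ → Vecℤ → Vecℤ
  Tℤ^ zero    a = a
  Tℤ^ (suc k) a = Tℤ (Tℤ^ k a)

  Tℤ^-+ : ∀ j k a → Tℤ^ (j + k) a ≗ Tℤ^ j (Tℤ^ k a)
  Tℤ^-+ zero    k a i = refl
  Tℤ^-+ (suc j) k a i = cong₂ _+ℤ_ (Tℤ^-+ j k a i) (Tℤ^-+ j k a (next i))

  Tℤ^-cong : ∀ {a b} k → a ≗ b → Tℤ^ k a ≗ Tℤ^ k b
  Tℤ^-cong zero    a≗b i = a≗b i
  Tℤ^-cong (suc k) a≗b i = cong₂ _+ℤ_ (Tℤ^-cong k a≗b i) (Tℤ^-cong k a≗b (next i))

  Tℤ^-cong-mod : ∀ {m a b} k → a ≋ b mod m → Tℤ^ k a ≋ Tℤ^ k b mod m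
  Tℤ^-cong-mod zero    a≋b i = a≋b i
  Tℤ^-cong-mod (suc k) a≋b i = mod-+ (Tℤ^-cong-mod k a≋b i) (Tℤ^-cong-mod k a≋b (next i))

  Tℤ^-additive : ∀ k a b → Tℤ^ k (λ j → a j +ℤ b j) ≗ λ i → Tℤ^ k a i +ℤ Tℤ^ k b i
  Tℤ^-additive zero    a b i = refl
  Tℤ^-additive (suc k) a b i = begin
    Tℤ^ k (λ j → a j +ℤ b j) i +ℤ Tℤ^ k (λ j → a j +ℤ b j) (next i)
      ≡⟨ cong₂ _+ℤ_ (Tℤ^-additive k a b i) (Tℤ^-additive k a b (next i)) ⟩
    (Tℤ^ k a i +ℤ Tℤ^ k b i) +ℤ (Tℤ^ k a (next i) +ℤ Tℤ^ k b (next i))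
      ≡⟨ interchange (Tℤ^ k a i) (Tℤ^ k b i) (Tℤ^ k a (next i)) (Tℤ^ k b (next i)) ⟩
    Tℤ^ (suc k) a i +ℤ Tℤ^ (suc k) b i ∎
    where
      open ≡-Reasoning
      interchange : ∀ x y z w → (x +ℤ y) +ℤ (z +ℤ w) ≡ (x +ℤ z) +ℤ (y +ℤ w)
      interchange = solve-∀

  Tℤ^-homogeneous : ∀ k c a → Tℤ^ k (λ j → c *ℤ a j) ≗ λ i → c *ℤ Tℤ^ k a i
  Tℤ^-homogeneous zero    c a i = refl
  Tℤ^-homogeneous (suc k) c a i = trans
    (cong₂ _+ℤ_ (Tℤ^-homogeneous k c a i) (Tℤ^-homogeneous k c a (next i)))
    (sym (ℤ.*-distribˡ-+ c (Tℤ^ k a i) (Tℤ^ k a (next i))))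

  Tℤ^-linear : ∀ k u c w → Tℤ^ k (λ j → u j +ℤ c *ℤ w j) ≗ λ i → Tℤ^ k u i +ℤ c *ℤ Tℤ^ k w i
  Tℤ^-linear k u c w i = trans (Tℤ^-additive k u _ i) (cong (Tℤ^ k u i +ℤ_) (Tℤ^-homogeneous k c w i))

  Tℤ^-zero : ∀ k → Tℤ^ k (λ _ → 0ℤ) ≗ λ _ → 0ℤ
  Tℤ^-zero zero    i = refl
  Tℤ^-zero (suc k) i = cong₂ _+ℤ_ (Tℤ^-zero k i) (Tℤ^-zero k (next i))

  Tℤ^-next : ∀ k a → Tℤ^ k (a ∘ next) ≗ Tℤ^ k a ∘ next
  Tℤ^-next zero    a i = refl
  Tℤ^-next (suc k) a i = cong₂ _+ℤ_ (Tℤ^-next k a i) (Tℤ^-next k a (next i))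

  record RepeatsFrom (m P N : ℕ) (b : Vecℤ) : Set where
    constructor repeatsFrom
    field repeats : Tℤ^ (N + P) b ≋ Tℤ^ N b mod m

  open RepeatsFrom

  module _ {m P N : ℕ} where

    repeatsFrom-resp : ∀ {a b} → a ≋ b mod m → RepeatsFrom m P N a → RepeatsFrom m P N b
    repeatsFrom-resp {a} {b} a≋b rep = repeatsFrom λ i → begin
      Tℤ^ (N + P) b i ≈⟨ mod-sym (Tℤ^-cong-mod (N + P) a≋b i) ⟩
      Tℤ^ (N + P) a i ≈⟨ repeats rep i ⟩
      Tℤ^ N a i       ≈⟨ Tℤ^-cong-mod N a≋b i ⟩
      Tℤ^ N b i       ∎
      where open ≡-mod-Reasoning m

    repeatsFrom-+ : ∀ {a b} → RepeatsFrom m P N a → RepeatsFrom m P N b →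
                    RepeatsFrom m P N (λ i → a i +ℤ b i)
    repeatsFrom-+ {a} {b} rep-a rep-b = repeatsFrom λ i → begin
      Tℤ^ (N + P) (λ j → a j +ℤ b j) i      ≡⟨ Tℤ^-additive (N + P) a b i ⟩
      Tℤ^ (N + P) a i +ℤ Tℤ^ (N + P) b i    ≈⟨ mod-+ (repeats rep-a i) (repeats rep-b i) ⟩
      Tℤ^ N a i +ℤ Tℤ^ N b i                ≡⟨ Tℤ^-additive N a b i ⟨
      Tℤ^ N (λ j → a j +ℤ b j) i            ∎
      where open ≡-mod-Reasoning m

    repeatsFrom-* : ∀ c {a} → RepeatsFrom m P N a → RepeatsFrom m P N (λ i → c *ℤ a i)
    repeatsFrom-* c {a} rep = repeatsFrom λ i → begin
      Tℤ^ (N + P) (λ j → c *ℤ a j) i ≡⟨ Tℤ^-homogeneous (N + P) c a i ⟩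
      c *ℤ Tℤ^ (N + P) a i           ≈⟨ mod-*ˡ c (repeats rep i) ⟩
      c *ℤ Tℤ^ N a i                 ≡⟨ Tℤ^-homogeneous N c a i ⟨
      Tℤ^ N (λ j → c *ℤ a j) i       ∎
      where open ≡-mod-Reasoning m

    repeatsFrom-zero : RepeatsFrom m P N (λ _ → 0ℤ)
    repeatsFrom-zero = repeatsFrom λ i → mod-reflexive (trans (Tℤ^-zero (N + P) i) (sym (Tℤ^-zero N i)))

    repeatsFrom-sum : ∀ {s} (f : Fin s → Vecℤ) → (∀ j → RepeatsFrom m P N (f j)) →
                      RepeatsFrom m P N (λ i → sum (λ j → f j i))
    repeatsFrom-sum {zero}  f rep = repeatsFrom-zero
    repeatsFrom-sum {suc s} f rep =
      repeatsFrom-+ (rep Fin.zero) (repeatsFrom-sum (f ∘ Fin.suc) (rep ∘ Fin.suc))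

    repeatsFrom-∘next : ∀ {a} → RepeatsFrom m P N a → RepeatsFrom m P N (a ∘ next)
    repeatsFrom-∘next {a} rep = repeatsFrom λ i → begin
      Tℤ^ (N + P) (a ∘ next) i ≡⟨ Tℤ^-next (N + P) a i ⟩
      Tℤ^ (N + P) a (next i)   ≈⟨ repeats rep (next i) ⟩
      Tℤ^ N a (next i)         ≡⟨ Tℤ^-next N a i ⟨
      Tℤ^ N (a ∘ next) i       ∎
      where open ≡-mod-Reasoning m

    repeatsFrom-indicator : RepeatsFrom m P N e₀ → ∀ j → RepeatsFrom m P N (indicator j)
    repeatsFrom-indicator rep₀ = >-weakInduction (λ j → RepeatsFrom m P N (indicator j)) repₙ step
      where
        back : ∀ j → RepeatsFrom m P N (indicator (next j)) → RepeatsFrom m P N (indicator j)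
        back j rep = repeatsFrom-resp (mod-reflexive ∘ indicator-next j) (repeatsFrom-∘next rep)
        repₙ : RepeatsFrom m P N (indicator (fromℕ n))
        repₙ = back (fromℕ n) (subst (RepeatsFrom m P N ∘ indicator) (sym next-fromℕ) rep₀)
        step : ∀ i → RepeatsFrom m P N (indicator (Fin.suc i)) → RepeatsFrom m P N (indicator (inject₁ i))
        step i = back (inject₁ i) ∘ subst (RepeatsFrom m P N ∘ indicator) (sym (next-inject₁ i))

    repeatsFrom-all : RepeatsFrom m P N e₀ → ∀ b → RepeatsFrom m P N b
    repeatsFrom-all rep₀ b = repeatsFrom-resp (mod-reflexive ∘ sum-indicator b) $
      repeatsFrom-sum (λ j i → b j *ℤ indicator j i) (λ j → repeatsFrom-* (b j) (repeatsFrom-indicator rep₀ j))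

  module _ {m : ℕ} where

    repeatsFrom-+ˡ : ∀ {P N b} c → RepeatsFrom m P N b → RepeatsFrom m P (c + N) b
    repeatsFrom-+ˡ {P} {N} {b} c rep = repeatsFrom λ i → begin
      Tℤ^ (c + N + P) b i        ≡⟨ cong (λ k → Tℤ^ k b i) (ℕ.+-assoc c N P) ⟩
      Tℤ^ (c + (N + P)) b i      ≡⟨ Tℤ^-+ c (N + P) b i ⟩
      Tℤ^ c (Tℤ^ (N + P) b) i    ≈⟨ Tℤ^-cong-mod c (repeats rep) i ⟩
      Tℤ^ c (Tℤ^ N b) i          ≡⟨ Tℤ^-+ c N b i ⟨
      Tℤ^ (c + N) b i            ∎
      where open ≡-mod-Reasoning m

    repeatsFrom-later : ∀ {P N N′ b} → N ≤ N′ → RepeatsFrom m P N b → RepeatsFrom m P N′ b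
    repeatsFrom-later {P} {N} {N′} {b} N≤N′ rep =
      subst (λ k → RepeatsFrom m P k b) (ℕ.m∸n+n≡m N≤N′) (repeatsFrom-+ˡ (N′ ∸ N) rep)

    repeatsFrom-*ˡ : ∀ {P N b} t → RepeatsFrom m P N b → RepeatsFrom m (t * P) N b
    repeatsFrom-*ˡ {P} {N} {b} zero    rep =
      repeatsFrom λ i → mod-reflexive (cong (λ k → Tℤ^ k b i) (ℕ.+-identityʳ N))
    repeatsFrom-*ˡ {P} {N} {b} (suc t) rep = repeatsFrom λ i → begin
      Tℤ^ (N + (P + t * P)) b i  ≡⟨ cong (λ k → Tℤ^ k b i) (rearrange N P (t * P)) ⟩
      Tℤ^ (N + t * P + P) b i    ≈⟨ repeats (repeatsFrom-later (ℕ.m≤m+n N (t * P)) rep) i ⟩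
      Tℤ^ (N + t * P) b i        ≈⟨ repeats (repeatsFrom-*ˡ t rep) i ⟩
      Tℤ^ N b i                  ∎
      where
        open ≡-mod-Reasoning m
        rearrange : ∀ a b c → a + (b + c) ≡ a + c + b
        rearrange = ℕ-Solver.solve-∀

    repeatsFrom-∸ : ∀ {X Y N b} → RepeatsFrom m (X + Y) N b → RepeatsFrom m Y N b → RepeatsFrom m X N b
    repeatsFrom-∸ {X} {Y} {N} {b} rep-X+Y rep-Y = repeatsFrom λ i → begin
      Tℤ^ (N + X) b i        ≈⟨ repeats (repeatsFrom-later (ℕ.m≤m+n N X) rep-Y) i ⟨
      Tℤ^ (N + X + Y) b i    ≡⟨ cong (λ k → Tℤ^ k b i) (ℕ.+-assoc N X Y) ⟩
      Tℤ^ (N + (X + Y)) b i  ≈⟨ repeats rep-X+Y i ⟩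
      Tℤ^ N b i              ∎
      where open ≡-mod-Reasoning m

    repeatsFrom-Tℤ^ : ∀ {P N K b} → RepeatsFrom m P (N + K) b → RepeatsFrom m P N (Tℤ^ K b)
    repeatsFrom-Tℤ^ {P} {N} {K} {b} rep = repeatsFrom λ i → begin
      Tℤ^ (N + P) (Tℤ^ K b) i ≡⟨ Tℤ^-+ (N + P) K b i ⟨
      Tℤ^ (N + P + K) b i     ≡⟨ cong (λ k → Tℤ^ k b i) (rearrange N P K) ⟩
      Tℤ^ (N + K + P) b i     ≈⟨ repeats rep i ⟩
      Tℤ^ (N + K) b i         ≡⟨ Tℤ^-+ N K b i ⟩
      Tℤ^ N (Tℤ^ K b) i       ∎
      where
        open ≡-mod-Reasoning m
        rearrange : ∀ a b c → a + b + c ≡ a + c + b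
        rearrange = ℕ-Solver.solve-∀

    repeatsFrom-pin : ∀ {P₀ P I N b} → 0 < P₀ → RepeatsFrom m P₀ I b → RepeatsFrom m P N b →
                      RepeatsFrom m P I b
    repeatsFrom-pin {P₀} {P} {I} {N} {b} 0<P₀ rep₀ rep = repeatsFrom λ i → begin
      Tℤ^ (I + P) b i              ≈⟨ repeats (repeatsFrom-later (ℕ.m≤m+n I P) cycles) i ⟨
      Tℤ^ (I + P + N * P₀) b i     ≡⟨ cong (λ k → Tℤ^ k b i) (rearrange I P (N * P₀)) ⟩
      Tℤ^ (I + N * P₀ + P) b i     ≈⟨ repeats (repeatsFrom-later N≤I+NP₀ rep) i ⟩
      Tℤ^ (I + N * P₀) b i         ≈⟨ repeats cycles i ⟩
      Tℤ^ I b i                    ∎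
      where
        open ≡-mod-Reasoning m
        cycles : RepeatsFrom m (N * P₀) I b
        cycles = repeatsFrom-*ˡ N rep₀
        N≤I+NP₀ : N ≤ I + N * P₀
        N≤I+NP₀ = ℕ.≤-trans (ℕ.m≤m*n N P₀ {{ℕ.>-nonZero 0<P₀}}) (ℕ.m≤n+m (N * P₀) I)
        rearrange : ∀ a b c → a + b + c ≡ a + c + b
        rearrange = ℕ-Solver.solve-∀

  EventuallyRepeatsMod : (m P : ℕ) → Vecℤ → Set
  EventuallyRepeatsMod m P b = ∃ λ N → RepeatsFrom m P N b

  Periodic : (m P : ℕ) → Set
  Periodic m P = ∀ b → EventuallyRepeatsMod m P b

  record IsLeastPeriod (m Q : ℕ) : Set where
    constructor isLeastPeriod
    field
      positive : 0 < Q
      periodic : Periodic m Q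
      least    : ∀ P → 0 < P → Periodic m P → Q ≤ P

  module _ {m : ℕ} where

    periodic-of-indicator : ∀ {P} → EventuallyRepeatsMod m P e₀ → Periodic m P
    periodic-of-indicator (N , rep₀) b = N , repeatsFrom-all rep₀ b

    periodic-*ˡ : ∀ {P} t → Periodic m P → Periodic m (t * P)
    periodic-*ˡ t per b = let (N , rep) = per b in N , repeatsFrom-*ˡ t rep

    periodic-∸ : ∀ {X Y} → Periodic m (X + Y) → Periodic m Y → Periodic m X
    periodic-∸ per-X+Y per-Y b =
      let (N₁ , rep-X+Y) = per-X+Y b
          (N₂ , rep-Y)   = per-Y b
      in N₁ + N₂ , repeatsFrom-∸ (repeatsFrom-later (ℕ.m≤m+n N₁ N₂) rep-X+Y)
                                 (repeatsFrom-later (ℕ.m≤n+m N₂ N₁) rep-Y)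

    leastPeriod-∣ : ∀ {Q P} → IsLeastPeriod m Q → Periodic m P → Q ℕ.∣ P
    leastPeriod-∣ {Q} {P} (isLeastPeriod 0<Q per-Q least) per-P =
      ℕ.m%n≡0⇒n∣m P Q $ ℕ.n≤0⇒n≡0 $ ℕ.≮⇒≥ λ 0<r → ℕ.<⇒≱ (m%n<n P Q) (least (P % Q) 0<r per-r)
      where
        instance _ = ℕ.>-nonZero 0<Q
        per-r : Periodic m (P % Q)
        per-r = periodic-∸ (subst (Periodic m) (m≡m%n+[m/n]*n P Q) per-P) (periodic-*ˡ (P / Q) per-Q)

    leastPeriod-unique : ∀ {Q Q′} → IsLeastPeriod m Q → IsLeastPeriod m Q′ → Q ≡ Q′
    leastPeriod-unique (isLeastPeriod 0<Q per-Q least) (isLeastPeriod 0<Q′ per-Q′ least′) =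
      ℕ.≤-antisym (least _ 0<Q′ per-Q′) (least′ _ 0<Q per-Q)

  periodic-∣ : ∀ {m m′ P} → m ℕ.∣ m′ → Periodic m′ P → Periodic m P
  periodic-∣ m∣m′ per b = let (N , rep) = per b in N , repeatsFrom (mod-∣ m∣m′ ∘ repeats rep)

  record Drift (m P N : ℕ) (b : Vecℤ) : Set where
    field
      drift         : Vecℤ
      step          : Tℤ^ (N + P) b ≗ λ i → Tℤ^ N b i +ℤ + m *ℤ drift i
      drift-repeats : RepeatsFrom m P 0 drift

  open Drift

  module _ {m P : ℕ} where

    step-later : ∀ {N b w} c → Tℤ^ (N + P) b ≗ (λ i → Tℤ^ N b i +ℤ + m *ℤ w i) →
                 Tℤ^ (c + N + P) b ≗ λ i → Tℤ^ (c + N) b i +ℤ + m *ℤ Tℤ^ c w i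
    step-later {N} {b} {w} c eq i = begin
      Tℤ^ (c + N + P) b i                      ≡⟨ cong (λ k → Tℤ^ k b i) (ℕ.+-assoc c N P) ⟩
      Tℤ^ (c + (N + P)) b i                    ≡⟨ Tℤ^-+ c (N + P) b i ⟩
      Tℤ^ c (Tℤ^ (N + P) b) i                  ≡⟨ Tℤ^-cong c eq i ⟩
      Tℤ^ c (λ j → Tℤ^ N b j +ℤ + m *ℤ w j) i ≡⟨ Tℤ^-linear c (Tℤ^ N b) (+ m) w i ⟩
      Tℤ^ c (Tℤ^ N b) i +ℤ + m *ℤ Tℤ^ c w i    ≡⟨ cong (_+ℤ + m *ℤ Tℤ^ c w i) (Tℤ^-+ c N b i) ⟨
      Tℤ^ (c + N) b i +ℤ + m *ℤ Tℤ^ c w i      ∎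
      where open ≡-Reasoning

    drift-later : ∀ {N b} c → Drift m P N b → Drift m P (c + N) b
    drift-later c D = record
      { drift         = Tℤ^ c (drift D)
      ; step          = step-later c (step D)
      ; drift-repeats = repeatsFrom-Tℤ^ (repeatsFrom-later (ℕ.m≤m+n 0 c) (drift-repeats D))
      }

    drift-exists : Periodic m P → ∀ b → ∃ λ N → Drift m P N b
    drift-exists per b =
      let (N  , rep-b) = per b
          w i          = proj₁ (mod⇒≡+* (repeats rep-b i))
          (N′ , rep-w) = per w
      in N′ + N , record
        { drift         = Tℤ^ N′ w
        ; step          = step-later N′ (proj₂ ∘ mod⇒≡+* ∘ repeats rep-b)
        ; drift-repeats = repeatsFrom-Tℤ^ rep-w
        }

    drift-iterate : ∀ {N b} (D : Drift m P N b) j →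
                    Tℤ^ (N + j * P) b ≋ (λ i → Tℤ^ N b i +ℤ + j *ℤ (+ m *ℤ drift D i)) mod m * m
    drift-iterate {N} {b} D zero i = mod-reflexive $ begin
      Tℤ^ (N + 0) b i                 ≡⟨ cong (λ k → Tℤ^ k b i) (ℕ.+-identityʳ N) ⟩
      Tℤ^ N b i                       ≡⟨ ℤ.+-identityʳ (Tℤ^ N b i) ⟨
      Tℤ^ N b i +ℤ 0ℤ                 ∎
      where open ≡-Reasoning
    drift-iterate {N} {b} D (suc j) i = begin
      Tℤ^ (N + (P + j * P)) b i
        ≡⟨ cong (λ k → Tℤ^ k b i) (rearrange N P (j * P)) ⟩
      Tℤ^ (P + (N + j * P)) b i
        ≡⟨ Tℤ^-+ P (N + j * P) b i ⟩
      Tℤ^ P (Tℤ^ (N + j * P) b) i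
        ≈⟨ Tℤ^-cong-mod P (drift-iterate D j) i ⟩
      Tℤ^ P (λ k → u k +ℤ + j *ℤ (+ m *ℤ w k)) i
        ≡⟨ Tℤ^-linear P u (+ j) (λ k → + m *ℤ w k) i ⟩
      Tℤ^ P u i +ℤ + j *ℤ Tℤ^ P (λ k → + m *ℤ w k) i
        ≡⟨ cong₂ (λ x y → x +ℤ + j *ℤ y) one-step (Tℤ^-homogeneous P (+ m) w i) ⟩
      (u i +ℤ + m *ℤ w i) +ℤ + j *ℤ (+ m *ℤ Tℤ^ P w i)
        ≈⟨ mod-+ (mod-refl {x = u i +ℤ + m *ℤ w i}) (mod-*ˡ (+ j) (mod-scale m w-repeats)) ⟩
      (u i +ℤ + m *ℤ w i) +ℤ + j *ℤ (+ m *ℤ w i)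
        ≡⟨ collect (u i) (+ m *ℤ w i) (+ j) ⟩
      u i +ℤ + suc j *ℤ (+ m *ℤ w i)
        ∎
      where
        open ≡-mod-Reasoning (m * m)
        u w : Vecℤ
        u = Tℤ^ N b
        w = drift D
        one-step : Tℤ^ P u i ≡ u i +ℤ + m *ℤ w i
        one-step = trans (sym (Tℤ^-+ P N b i)) (trans (cong (λ k → Tℤ^ k b i) (ℕ.+-comm P N)) (step D i))
        w-repeats : Tℤ^ P w i ≡ w i mod m
        w-repeats = repeats (drift-repeats D) i
        rearrange : ∀ a b c → a + (b + c) ≡ b + (a + c)
        rearrange = ℕ-Solver.solve-∀
        collect : ∀ u z j → (u +ℤ z) +ℤ j *ℤ z ≡ u +ℤ (1ℤ +ℤ j) *ℤ z
        collect = solve-∀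

  periodic-scale : ∀ {d m P} → d ℕ.∣ m → Periodic m P → Periodic (d * m) (d * P)
  periodic-scale {d} {m} {P} d∣m per b = let (N , D) = drift-exists per b in
    N , repeatsFrom λ i → mod-trans (mod-∣ (ℕ.*-monoˡ-∣ m d∣m) (drift-iterate D d i))
                                    (∣⇒x+z≡x-mod (dm∣d[mw] (drift D i)))
    where
      dm∣d[mw] : ∀ w → + (d * m) ∣ + d *ℤ (+ m *ℤ w)
      dm∣d[mw] w = subst (_∣ + d *ℤ (+ m *ℤ w)) (sym (ℤ.pos-* d m)) (*-monoʳ-∣ (+ d) (∣m⇒∣m*n w ∣-refl))

  periodic-descend : ∀ {d m Q} .{{_ : NonZero d}} → d * d ℕ.∣ m →
                     Periodic m Q → Periodic (d * (d * m)) (d * Q) → Periodic (d * m) Q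
  periodic-descend {d} {m} {Q} dd∣m per-Q per-dQ b =
    let (N₁ , rep) = per-dQ b
        (N  , D₀)  = drift-exists per-Q b
        D          = drift-later N₁ D₀
        u          = Tℤ^ (N₁ + N) b
        stalls : ∀ i → u i +ℤ + d *ℤ (+ m *ℤ drift D i) ≡ u i mod d * (d * m)
        stalls i   = mod-trans (mod-sym (mod-∣ ddm∣mm (drift-iterate D d i)))
                               (repeats (repeatsFrom-later (ℕ.m≤m+n N₁ N) rep) i)
    in N₁ + N , repeatsFrom λ i →
         subst (_≡ u i mod d * m) (sym (step D i)) (∣⇒x+z≡x-mod (cancel (x+z≡x-mod⇒∣ (stalls i))))
    where
      ddm∣mm : d * (d * m) ℕ.∣ m * m
      ddm∣mm = subst (ℕ._∣ m * m) (ℕ.*-assoc d d m) (ℕ.*-monoˡ-∣ m dd∣m)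
      cancel : ∀ {z} → + (d * (d * m)) ∣ + d *ℤ z → + (d * m) ∣ z
      cancel {z} = *-cancelˡ-∣ (+ d) ∘ subst (_∣ + d *ℤ z) (ℤ.pos-* d (d * m))

  leastPeriod-scale : ∀ {d m Q Q′} → d ℕ.∣ m → IsLeastPeriod m Q → IsLeastPeriod (d * m) Q′ →
                      Q ℕ.∣ Q′ × Q′ ℕ.∣ d * Q
  leastPeriod-scale {d} d∣m least-Q@(isLeastPeriod _ per-Q _) least-Q′@(isLeastPeriod _ per-Q′ _) =
    leastPeriod-∣ least-Q (periodic-∣ (ℕ.n∣m*n d) per-Q′) , leastPeriod-∣ least-Q′ (periodic-scale d∣m per-Q)

  leastPeriod-cannot-stall : ∀ {d m Q Q″} .{{_ : NonZero d}} → 1 < d → d * d ℕ.∣ m →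
                             IsLeastPeriod m Q → IsLeastPeriod (d * m) (d * Q) →
                             IsLeastPeriod (d * (d * m)) Q″ → Q″ ≢ d * Q
  leastPeriod-cannot-stall {d} {m} {Q} 1<d dd∣m (isLeastPeriod 0<Q per-Q _) (isLeastPeriod _ _ least-dQ)
                           (isLeastPeriod _ per-dQ _) refl =
    ℕ.<⇒≱ Q<dQ (least-dQ Q 0<Q (periodic-descend dd∣m per-Q per-dQ))
    where
      Q<dQ : Q < d * Q
      Q<dQ = subst (Q <_) (ℕ.*-comm Q d) (ℕ.m<m*n Q d {{ℕ.>-nonZero 0<Q}} 1<d)

  repeatsFrom? : ∀ m P N b → Dec (RepeatsFrom m P N b)
  repeatsFrom? m P N b =
    Dec.map′ repeatsFrom repeats (Fin.all? (λ i → Tℤ^ (N + P) b i ≡? Tℤ^ N b i mod m))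

  module FiniteOrbits (m′ : ℕ) where

    lift : Vecₘ (suc m′) (suc n) → Vecℤ
    lift a i = + toℕ (a i)

    lift-T^ : ∀ k a → lift (T^ k a) ≋ Tℤ^ k (lift a) mod suc m′
    lift-T^ zero    a i = mod-refl
    lift-T^ (suc k) a i =
      mod-trans (toℕ-+ₘ (T^ k a i) (T^ k a (next i))) (mod-+ (lift-T^ k a i) (lift-T^ k a (next i)))

    eventuallyRepeats⇒ : ∀ {a P} → EventuallyRepeats a P → EventuallyRepeatsMod (suc m′) P (lift a)
    eventuallyRepeats⇒ {a} {P} (N , eq) = N , repeatsFrom λ i → begin
      Tℤ^ (N + P) (lift a) i  ≈⟨ lift-T^ (N + P) a i ⟨
      lift (T^ (N + P) a) i   ≡⟨ cong (+_ ∘ toℕ) (eq N ℕ.≤-refl i) ⟩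
      lift (T^ N a) i         ≈⟨ lift-T^ N a i ⟩
      Tℤ^ N (lift a) i        ∎
      where open ≡-mod-Reasoning (suc m′)

    eventuallyRepeats⇐ : ∀ {a P} → EventuallyRepeatsMod (suc m′) P (lift a) → EventuallyRepeats a P
    eventuallyRepeats⇐ {a} {P} (N , rep) = N , λ k N≤k i → Fin.toℕ-injective $
      ≡-mod⇒≡ (Fin.toℕ<n _) (Fin.toℕ<n _) $ begin
        lift (T^ (k + P) a) i   ≈⟨ lift-T^ (k + P) a i ⟩
        Tℤ^ (k + P) (lift a) i  ≈⟨ repeats (repeatsFrom-later N≤k rep) i ⟩
        Tℤ^ k (lift a) i        ≈⟨ lift-T^ k a i ⟨
        lift (T^ k a) i         ∎
      where open ≡-mod-Reasoning (suc m′)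

    unitₘ : Vecₘ (suc m′) (suc n)
    unitₘ Fin.zero    = fromℕ< (m%n<n 1 (suc m′))
    unitₘ (Fin.suc _) = Fin.zero

    lift-unitₘ : lift unitₘ ≋ e₀ mod suc m′
    lift-unitₘ Fin.zero    = mod-trans (mod-reflexive (cong +_ (Fin.toℕ-fromℕ< _))) (%-≡-mod 1 (suc m′))
    lift-unitₘ (Fin.suc _) = mod-refl

    periodic⇒eventuallyRepeats : ∀ {P} → Periodic (suc m′) P → ∀ a → EventuallyRepeats a P
    periodic⇒eventuallyRepeats per a = eventuallyRepeats⇐ (per (lift a))

    unitₘ-eventuallyRepeats⇒periodic : ∀ {P} → EventuallyRepeats unitₘ P → Periodic (suc m′) P
    unitₘ-eventuallyRepeats⇒periodic er =
      let (N , rep) = eventuallyRepeats⇒ er in periodic-of-indicator (N , repeatsFrom-resp lift-unitₘ rep)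

    -- Opaque because unfolding the pigeonhole witness during type checking is prohibitively slow.
    opaque
      indicator-eventually-cycles : ∃₂ λ I P₀ → 0 < P₀ × RepeatsFrom (suc m′) P₀ I e₀
      indicator-eventually-cycles =
        let (i , j , i<j , fᵢ≡fⱼ) = Fin.pigeonhole (ℕ.n<1+n K) f
            T^ᵢ≗T^ⱼ x = trans (sym (Fin.finToFun-funToFin (T^ (toℕ i) unitₘ) x)) $
                        trans (cong (λ y → Fin.finToFun y x) fᵢ≡fⱼ) (Fin.finToFun-funToFin (T^ (toℕ j) unitₘ) x)
        in toℕ i , toℕ j ∸ toℕ i , ℕ.m<n⇒0<n∸m i<j , repeatsFrom λ x → begin
          Tℤ^ (toℕ i + (toℕ j ∸ toℕ i)) e₀ x  ≡⟨ cong (λ k → Tℤ^ k e₀ x) (ℕ.m+[n∸m]≡n (ℕ.<⇒≤ i<j)) ⟩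
          Tℤ^ (toℕ j) e₀ x                    ≈⟨ Tℤ^-indicator (toℕ j) x ⟩
          lift (T^ (toℕ j) unitₘ) x           ≡⟨ cong (+_ ∘ toℕ) (T^ᵢ≗T^ⱼ x) ⟨
          lift (T^ (toℕ i) unitₘ) x           ≈⟨ Tℤ^-indicator (toℕ i) x ⟨
          Tℤ^ (toℕ i) e₀ x                    ∎
        where
          open ≡-mod-Reasoning (suc m′)
          K : ℕ
          K = suc m′ ^ suc n
          f : Fin (suc K) → Fin K
          f k = Fin.funToFin (T^ (toℕ k) unitₘ)
          Tℤ^-indicator : ∀ k → Tℤ^ k e₀ ≋ lift (T^ k unitₘ) mod suc m′
          Tℤ^-indicator k x = mod-trans (Tℤ^-cong-mod k (mod-sym ∘ lift-unitₘ) x) (mod-sym (lift-T^ k unitₘ x))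

    opaque
      leastPeriod-exists : ∃ (IsLeastPeriod (suc m′))
      leastPeriod-exists with indicator-eventually-cycles
      ... | I , P₀ , 0<P₀ , rep₀
        with least-satisfying {P = λ P → 0 < P × RepeatsFrom (suc m′) P I e₀}
                              (λ P → 0 ℕ.<? P ×-dec repeatsFrom? (suc m′) P I e₀) (0<P₀ , rep₀)
      ... | L , (0<L , rep-L) , least =
        L , isLeastPeriod 0<L (periodic-of-indicator (I , rep-L))
              (λ P 0<P per → least P (0<P , repeatsFrom-pin 0<P₀ rep₀ (proj₂ (per e₀))))

    isLeastPeriod⇒isPeriod : ∀ {L} → IsLeastPeriod (suc m′) L → IsPeriod (suc m′) (suc n) L
    isLeastPeriod⇒isPeriod (isLeastPeriod 0<L per-L least) =
      (unitₘ , 0<L , periodic⇒eventuallyRepeats per-L unitₘ ,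
               λ P 0<P er → least P 0<P (unitₘ-eventuallyRepeats⇒periodic er)) ,
      λ a L′ (_ , _ , least-a) → least-a _ 0<L (periodic⇒eventuallyRepeats per-L a)

  leastPeriod-exists : ∀ {m} → 0 < m → ∃ (IsLeastPeriod m)
  leastPeriod-exists {suc m′} _ = FiniteOrbits.leastPeriod-exists m′

  isPeriod⇒isLeastPeriod : ∀ {m Q} → IsPeriod m (suc n) Q → IsLeastPeriod m Q
  isPeriod⇒isLeastPeriod {zero}    ((a , _) , _) with () ← a Fin.zero
  isPeriod⇒isLeastPeriod {suc m′} isPeriod-Q with leastPeriod-exists {suc m′} (s≤s z≤n)
  ... | L , least-L = subst (IsLeastPeriod (suc m′))
                            (isPeriod-unique (FiniteOrbits.isLeastPeriod⇒isPeriod m′ least-L) isPeriod-Q) least-L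

  module _ {p : ℕ} (p-prime : Prime p) where

    private instance
      p≢0 : NonZero p
      p≢0 = prime⇒nonZero p-prime

    p^k-ratio : ∀ {k Q Q′} → 1 ≤ k → IsLeastPeriod (p ^ k) Q → IsLeastPeriod (p ^ suc k) Q′ →
                Q′ ≡ Q ⊎ Q′ ≡ p * Q
    p^k-ratio {suc k} _ least-Q least-Q′ =
      uncurry (m∣n∣p*m⇒n≡m⊎n≡p*m p-prime (IsLeastPeriod.positive least-Q))
              (leastPeriod-scale (ℕ.m∣m*n {p} (p ^ k)) least-Q least-Q′)

    p^k-growth-persists : ∀ {k Q Q′ Q″} → 2 ≤ k →
                          IsLeastPeriod (p ^ k) Q → IsLeastPeriod (p ^ suc k) Q′ →
                          IsLeastPeriod (p ^ suc (suc k)) Q″ → Q′ ≡ p * Q → Q″ ≡ p * Q′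
    p^k-growth-persists {k@(suc (suc k′))} {Q} {Q″ = Q″} (s≤s (s≤s _)) least-Q least-pQ least-Q″ refl =
      Sum.[ (λ Q″≡pQ → contradiction Q″≡pQ stall-impossible) , id ]′
        (p^k-ratio {suc k} (s≤s z≤n) least-pQ least-Q″)
      where
        1<p : 1 < p
        1<p = ℕ.nonTrivial⇒n>1 p {{prime⇒nonTrivial p-prime}}
        pp∣p^k : p * p ℕ.∣ p ^ k
        pp∣p^k = ℕ.*-monoʳ-∣ p (ℕ.m∣m*n {p} (p ^ k′))
        stall-impossible : Q″ ≢ p * Q
        stall-impossible = leastPeriod-cannot-stall 1<p pp∣p^k least-Q least-pQ least-Q″

    p^k-geometric : ∀ {N Q} → 2 ≤ N → IsLeastPeriod (p ^ N) Q → IsLeastPeriod (p ^ suc N) (p * Q) →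
                    ∀ j {R} → IsLeastPeriod (p ^ (j + N)) R → R ≡ p ^ j * Q
    p^k-geometric {N} {Q} 2≤N least-Q least-pQ = geometric
      where
        exists : ∀ j → ∃ (IsLeastPeriod (p ^ (j + N)))
        exists j = leastPeriod-exists (ℕ.m^n>0 p (j + N))

        ratio : ∀ j {R R′} → IsLeastPeriod (p ^ (j + N)) R → IsLeastPeriod (p ^ suc (j + N)) R′ →
                R′ ≡ p * R
        ratio zero    least-R least-R′ =
          trans (leastPeriod-unique least-R′ least-pQ) (cong (p *_) (leastPeriod-unique least-Q least-R))
        ratio (suc j) least-R least-R′ =
          p^k-growth-persists {j + N} (ℕ.≤-trans 2≤N (ℕ.m≤n+m N j)) least-S least-R least-R′
                              (ratio j least-S least-R)
          where least-S = proj₂ (exists j)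

        geometric : ∀ j {R} → IsLeastPeriod (p ^ (j + N)) R → R ≡ p ^ j * Q
        geometric zero    least-R = trans (leastPeriod-unique least-R least-Q) (sym (ℕ.*-identityˡ Q))
        geometric (suc j) {R} least-R = begin
          R               ≡⟨ ratio j least-S least-R ⟩
          p * S           ≡⟨ cong (p *_) (geometric j least-S) ⟩
          p * (p ^ j * Q) ≡⟨ ℕ.*-assoc p (p ^ j) Q ⟨
          p ^ suc j * Q   ∎
          where
            open ≡-Reasoning
            S = proj₁ (exists j)
            least-S = proj₂ (exists j)

theorem5p1 : (p : ℕ) → Prime p → (n : ℕ) → 1 ≤ n →
    ((k : ℕ) → 1 ≤ k → (Q Q′ : ℕ) →
       IsPeriod (p ^ k) n Q → IsPeriod (p ^ (k + 1)) n Q′ →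
       Q′ ≡ Q ⊎ Q′ ≡ p * Q)
    ×
    ((k : ℕ) → 2 ≤ k → (Q Q′ Q″ : ℕ) →
       IsPeriod (p ^ k) n Q → IsPeriod (p ^ (k + 1)) n Q′ →
       IsPeriod (p ^ (k + 2)) n Q″ →
       Q′ ≡ p * Q → Q″ ≡ p * Q′)
    ×
    ((N : ℕ) → 2 ≤ N → (Q Q′ : ℕ) →
       IsPeriod (p ^ N) n Q → IsPeriod (p ^ (N + 1)) n Q′ →
       Q′ ≡ p * Q →
       (j : ℕ) → 1 ≤ j → (R : ℕ) → IsPeriod (p ^ (N + j)) n R →
       R ≡ p ^ j * Q)
theorem5p1 p p-prime (suc n) _ =
  (λ k 1≤k _ _ h h′ → p^k-ratio p-prime 1≤k (least h) (least′ (ℕ.+-comm k 1) h′)) ,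
  (λ k 2≤k _ _ _ h h′ h″ →
     p^k-growth-persists p-prime 2≤k (least h) (least′ (ℕ.+-comm k 1) h′) (least′ (ℕ.+-comm k 2) h″)) ,
  (λ N 2≤N _ _ h h′ Q′≡pQ j _ _ hR →
     p^k-geometric p-prime 2≤N (least h) (subst (IsLeastPeriod _) Q′≡pQ (least′ (ℕ.+-comm N 1) h′))
                   j (least′ (ℕ.+-comm N j) hR))
  where
    open Orbits n
    least : ∀ {m Q} → IsPeriod m (suc n) Q → IsLeastPeriod m Q
    least = isPeriod⇒isLeastPeriod
    least′ : ∀ {e e′ Q} → e ≡ e′ → IsPeriod (p ^ e) (suc n) Q → IsLeastPeriod (p ^ e′) Q
    least′ refl = least
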